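{- Let $\alpha$ be a strong composition of length $k$ and $\beta$ a weak composition of length $n\ge k$. Form $\alpha'$ from $\alpha$ by appending $n-k$ zeros. Then $\tilde{\mathcal{A}}_{\alpha'}\cdot\tilde{\mathcal{A}}_\beta$ is a linear combination of fundamental Demazure atoms $\tilde{\mathcal{A}}_\gamma$ (with $\gamma$ weak compositions of length $n$) with nonnegative integer coefficients.
   Context: A strong composition has all entries positive; a weak composition of length $n$ is $\gamma\in\mathbb{Z}_{\ge0}^n$; $x^\gamma=\prod x_i^{\gamma_i}$. $\operatorname{flat}(\gamma)$ moves all zeros to the right end keeping the order of nonzero entries. $S_n$ acts on length-$n$ vectors with $s_i$ swapping positions $i,i+1$; $w_\gamma$ is a minimal length permutation with $w_\gamma(\gamma)=\operatorname{flat}(\gamma)$. $\tilde{s}_i(\gamma)$ swaps positions $i,i+1$ if $\gamma_i=0$ or $\gamma_{i+1}=0$ and fixes $\gamma$ otherwise. $\tilde{\pi}_i(x^\gamma)=\dfrac{x_ix^\gamma-x_{i+1}x^{\tilde{s}_i(\gamma)}}{x_i-x_{i+1}}$ (linear), $\tilde{\theta}_i=\tilde{\pi}_i-1$, $\tilde{\theta}_w=\tilde{\theta}_{i_1}\cdots\tilde{\theta}_{i_k}$ for a reduced word $w=s_{i_1}\cdots s_{i_k}$ (independent of the reduced word). Fundamental Demazure atom: $\tilde{\mathcal{A}}_\gamma=\tilde{\theta}_{w_\gamma^{ -1}}x^{\operatorname{flat}(\gamma)}$. The $\tilde{\mathcal{A}}_\gamma$ form a basis of $\mathbb{C}[x_1,\ldots,x_n]$.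 -}

module Defs where

open import Data.Nat as ℕ using (ℕ; zero; suc; _∸_; _≤ᵇ_)
open import Data.Integer as ℤ using (ℤ; +_; -_)
open import Data.Bool using (Bool; true; false; if_then_else_; _∨_)
open import Data.List as List using (List; []; _∷_; _++_; map; concatMap; upTo; reverse; zipWith; length; concat; foldl)
open import Data.Vec as Vec using (Vec; []; _∷_; _∷ʳ_)
open import Data.Vec.Properties using (≡-dec)
open import Data.Product using (_×_; _,_)
open import Relation.Nullary.Decidable using (does)
open import Relation.Binary.PropositionalEquality using (_≡_)

-- Exponent vectors (weak compositions of length n); position indices are 0-based.
Exp : ℕ → Set
Exp n = Vec ℕ n

-- A polynomial in ℤ[x_1..x_n] as a formal sum of terms c·x^e (duplicates allowed).
Poly : ℕ → Set
Poly n = List (ℤ × Exp n)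

coeff : ∀ {n} → Poly n → Exp n → ℤ
coeff [] γ = + 0
coeff ((c , e) ∷ p) γ =
  (if does (≡-dec ℕ._≟_ e γ) then c else + 0) ℤ.+ coeff p γ

_≈P_ : ∀ {n} → Poly n → Poly n → Set
p ≈P q = ∀ γ → coeff p γ ≡ coeff q γ

scaleP : ∀ {n} → ℤ → Poly n → Poly n
scaleP d = map (λ { (c , e) → (d ℤ.* c , e) })

_*P_ : ∀ {n} → Poly n → Poly n → Poly n
p *P q = concatMap (λ { (c , e) → map (λ { (d , f) → (c ℤ.* d , Vec.zipWith ℕ._+_ e f) }) q }) p

-- entry at position i (0 if out of range)
get : ∀ {n} → Exp n → ℕ → ℕ
get [] _ = 0
get (x ∷ _) zero = x
get (_ ∷ xs) (suc i) = get xs i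

setAt : ∀ {n} → Exp n → ℕ → ℕ → Exp n
setAt [] _ _ = []
setAt (_ ∷ xs) zero v = v ∷ xs
setAt (x ∷ xs) (suc i) v = x ∷ setAt xs i v

isZero : ℕ → Bool
isZero zero = true
isZero (suc _) = false

-- π̃_i (x_i, x_{i+1} are positions i, i+1, 0-based) applied to c·x^γ.
-- With a = γ_i, b = γ_{i+1}:
--  * if a ≠ 0 and b ≠ 0 then s̃_i γ = γ and π̃_i x^γ = (x_i - x_{i+1}) x^γ / (x_i - x_{i+1}) = x^γ;
--  * otherwise s̃_i γ = s_i γ and the exact quotient
--    (x_i^{a+1} x_{i+1}^b - x_{i+1}^{a+1} x_i^b)/(x_i - x_{i+1}) (times the other variables) is
--      Σ_{j=b}^{a} x_i^j x_{i+1}^{a+b-j}            if b ≤ a,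
--     -Σ_{j=a+1}^{b-1} x_i^j x_{i+1}^{a+b-j}        if a < b.
piTerm : ∀ {n} → ℕ → ℤ × Exp n → Poly n
piTerm i (c , γ) =
  if isZero a ∨ isZero b
  then (if b ≤ᵇ a
        then map (λ j → (c , mono j)) (map (b ℕ.+_) (upTo (suc (a ∸ b))))
        else map (λ j → (- c , mono j)) (map (suc a ℕ.+_) (upTo (b ∸ suc a))))
  else ((c , γ) ∷ [])
  where
  a = get γ i
  b = get γ (suc i)
  mono : ℕ → Exp _
  mono j = setAt (setAt γ i j) (suc i) ((a ℕ.+ b) ∸ j)

piT : ∀ {n} → ℕ → Poly n → Poly n
piT i p = concatMap (piTerm i) p

thetaT : ∀ {n} → ℕ → Poly n → Poly n
thetaT i p = piT i p ++ scaleP (- (+ 1)) p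

flat : ∀ {n} → Exp n → Exp n
flat [] = []
flat (x ∷ xs) = if isZero x then flat xs ∷ʳ 0 else x ∷ flat xs

nzPos : ∀ {n} → ℕ → Exp n → List ℕ
nzPos _ [] = []
nzPos k (x ∷ xs) = if isZero x then nzPos (suc k) xs else k ∷ nzPos (suc k) xs

-- A reduced word (i_1, …, i_ℓ) such that s_{i_ℓ} ⋯ s_{i_1} flat(γ) = γ, i.e. of
-- w_γ⁻¹ = s_{i_ℓ} ⋯ s_{i_1} where w_γ is the minimal length permutation with
-- w_γ(γ) = flat(γ): the j-th nonzero entry (j = m-1 down to 0, 0-based) is moved from
-- position j to its position p_j in γ via s_j, s_{j+1}, …, s_{p_j - 1}.
-- Length Σ (p_j - j) = #{zero before nonzero pairs of γ} = ℓ(w_γ).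
segment : ℕ → ℕ → List ℕ
segment j p = map (j ℕ.+_) (upTo (p ∸ j))

atomWord : ∀ {n} → Exp n → List ℕ
atomWord γ = concat (reverse (zipWith segment (upTo (length ps)) ps))
  where ps = nzPos 0 γ

-- Fundamental Demazure atom Ã_γ = θ̃_{w_γ⁻¹} x^{flat γ}
--   = θ̃_{i_ℓ} ⋯ θ̃_{i_1} x^{flat γ}   (θ̃_{i_1} applied first).
atom : ∀ {n} → Exp n → Poly n
atom γ = foldl (λ p i → thetaT i p) ((+ 1 , flat γ) ∷ []) (atomWord γ)

atomComb : ∀ {n} → List (ℕ × Exp n) → Poly n
atomComb cs = concatMap (λ { (m , γ) → scaleP (+ m) (atom γ) }) cs

padZeros : ∀ {k} (m : ℕ) → Exp k → Exp (k ℕ.+ m)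
padZeros m α = α Vec.++ Vec.replicate m 0

{-# OPTIONS --safe #-}
-- θ̃ᵢ acts on coefficient functions by an explicit transposed rule (thetaCoeff), so by
-- induction along the reduced word of w_γ⁻¹ every fundamental atom Ã_γ is multiplicity free:
-- its coefficient at x^b is 1 exactly when b splits into blocks, one for each nonzero entry of
-- γ (inAtom), and 0 otherwise. As α is strong, α' is flat and Ã_α' = x^α'. The monomials of
-- x^α' Ã_β are the x^b with b ≥ α' and b − α' in the support of Ã_β. Grouped by their first k
-- exponents w, which are positive, those with a fixed w are exactly the monomials of
-- Ã_(w ++ τ), where τ is the tail of β with the block sum left over from the first k positions
-- subtracted from its first nonzero entry. So the product is a 0/1 combination of atoms
-- indexed by a finite box of prefixes w.
module Submission where

open import Defs
open import Data.Nat using (ℕ; _+_; _<_)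
open import Data.Vec using (Vec)
open import Data.Vec.Relation.Unary.All using (All)
open import Data.List using (List)
open import Data.Product using (Σ; _×_)

open import Algebra.Bundles using (CommutativeMonoid)
open import Data.Bool using (T; Bool; true; false; if_then_else_; _∧_; _∨_; not)
import Data.Bool.Properties as BoolP
open import Data.Empty using (⊥-elim)
open import Data.Integer as ℤ using (ℤ; +_; -_)
import Data.Integer.Properties as ℤP
open import Data.Integer.Tactic.RingSolver using (solve-∀)
open import Data.List using ([]; _∷_; _++_; map; upTo; applyUpTo; length; replicate; foldl; concat; concatMap; reverse; zipWith)
import Data.List.Properties as ListP
open import Data.Maybe using (Maybe; just; nothing; maybe′; fromMaybe)
open import Data.Nat as ℕ using (zero; suc; _∸_; _≡ᵇ_; s≤s; z≤n)
open import Data.Nat.ListAction using (sum)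
open import Data.Nat.ListAction.Properties using (sum-++)
import Data.Nat.Properties as ℕP
open import Data.Product using (_,_; proj₂)
open import Data.Vec as Vec using ([]; _∷_)
open import Data.Vec.Properties using (≡-dec; toList-∷ʳ)
import Data.Vec.Properties as VecP
open import Data.Vec.Relation.Unary.All using ([]; _∷_)
open import Function using (_∘_)
open import Function.Bundles using (Equivalence)
open import Relation.Binary.PropositionalEquality
open import Relation.Nullary.Decidable using (does; yes; no)
open import Algebra.Properties.CommutativeSemigroup ℕP.+-commutativeSemigroup
  using () renaming (xy∙z≈xz∙y to +-right-comm; interchange to +-interchange)
open import Algebra.Properties.CommutativeSemigroup ℤP.+-commutativeSemigroup
  using () renaming (interchange to ℤ-+-interchange)
open import Algebra.Properties.CommutativeSemigroup (CommutativeMonoid.commutativeSemigroup BoolP.∧-commutativeMonoid)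
  using () renaming (interchange to ∧-interchange; x∙yz≈y∙xz to ∧-swap)
open ≡-Reasoning

when : Bool → ℤ → ℤ
when b c = if b then c else + 0

when-0 : ∀ b → when b (+ 0) ≡ + 0
when-0 true = refl
when-0 false = refl

when-+ : ∀ b x y → when b (x ℤ.+ y) ≡ when b x ℤ.+ when b y
when-+ true x y = refl
when-+ false x y = refl

when-∧ : ∀ a b x → when a (when b x) ≡ when (a ∧ b) x
when-∧ true b x = refl
when-∧ false b x = refl

T⇒≡true : ∀ {b} → T b → b ≡ true
T⇒≡true = Equivalence.to BoolP.T-≡

≡true⇒T : ∀ {b} → b ≡ true → T b
≡true⇒T = Equivalence.from BoolP.T-≡

≡ᵇ⇒≡ : ∀ m n → (m ≡ᵇ n) ≡ true → m ≡ n
≡ᵇ⇒≡ m n eq = ℕP.≡ᵇ⇒≡ m n (≡true⇒T eq)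

≡ᵇ-refl : ∀ n → (n ≡ᵇ n) ≡ true
≡ᵇ-refl n = T⇒≡true (ℕP.≡⇒≡ᵇ n n refl)

≢⇒≡ᵇ-false : ∀ m n → m ≢ n → (m ≡ᵇ n) ≡ false
≢⇒≡ᵇ-false m n m≢n with m ≡ᵇ n in eq
... | true = ⊥-elim (m≢n (≡ᵇ⇒≡ m n eq))
... | false = refl

≡ᵇ-cong : ∀ x y x′ y′ → (x ≡ y → x′ ≡ y′) → (x′ ≡ y′ → x ≡ y) → (x ≡ᵇ y) ≡ (x′ ≡ᵇ y′)
≡ᵇ-cong x y x′ y′ to from with x ℕ.≟ y
... | yes refl rewrite to refl = trans (≡ᵇ-refl x) (sym (≡ᵇ-refl y′))
... | no x≢y = trans (≢⇒≡ᵇ-false x y x≢y) (sym (≢⇒≡ᵇ-false x′ y′ (x≢y ∘ from)))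

≡ᵇ-sym : ∀ x y → (x ≡ᵇ y) ≡ (y ≡ᵇ x)
≡ᵇ-sym x y = ≡ᵇ-cong x y y x sym sym

<ᵇ-suc : ∀ x z → (x ℕ.<ᵇ suc z) ≡ (x ℕ.≤ᵇ z)
<ᵇ-suc zero z = refl
<ᵇ-suc (suc x) z = refl

+-≡ᵇ : ∀ x y z → (x + y ≡ᵇ z) ≡ (x ℕ.≤ᵇ z) ∧ (y ≡ᵇ z ∸ x)
+-≡ᵇ zero y z = refl
+-≡ᵇ (suc x) y zero = refl
+-≡ᵇ (suc x) y (suc z) rewrite <ᵇ-suc x z = +-≡ᵇ x y z

termCoeff : ∀ {n} → ℤ × Exp n → Exp n → ℤ
termCoeff (c , e) γ = when (does (≡-dec ℕ._≟_ e γ)) c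

coeff-++ : ∀ {n} (p q : Poly n) γ → coeff (p ++ q) γ ≡ coeff p γ ℤ.+ coeff q γ
coeff-++ [] q γ = sym (ℤP.+-identityˡ _)
coeff-++ (t ∷ p) q γ rewrite coeff-++ p q γ = sym (ℤP.+-assoc (termCoeff t γ) (coeff p γ) (coeff q γ))

coeff-scaleP : ∀ {n} d (p : Poly n) γ → coeff (scaleP d p) γ ≡ d ℤ.* coeff p γ
coeff-scaleP d [] γ = sym (ℤP.*-zeroʳ d)
coeff-scaleP d ((c , e) ∷ p) γ rewrite coeff-scaleP d p γ with does (≡-dec ℕ._≟_ e γ)
... | true = sym (ℤP.*-distribˡ-+ d c (coeff p γ))
... | false = trans (cong (ℤ._+ (d ℤ.* coeff p γ)) (sym (ℤP.*-zeroʳ d))) (sym (ℤP.*-distribˡ-+ d (+ 0) (coeff p γ)))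

-- The action of θ̃ᵢ on coefficients

pairAt : ∀ {n} → Exp n → ℕ → ℕ → ℕ → Exp n
pairAt γ i l r = setAt (setAt γ i l) (suc i) r

-- In the variables xᵢ, xᵢ₊₁: θ̃ᵢ x^(s,0) = −θ̃ᵢ x^(0,s) is the sum of the x^(p,q) with
-- p + q = s and q > 0, and θ̃ᵢ x^(p,q) = 0 for p, q > 0. Reading this off column by column
-- gives the coefficients of θ̃ᵢ g in terms of those of g.
thetaCoeff : ∀ {n} → ℕ → (Exp n → ℤ) → Exp n → ℤ
thetaCoeff i g b =
  if isZero (get b (suc i)) then + 0
  else g (pairAt b i (get b i + get b (suc i)) 0) ℤ.- g (pairAt b i 0 (get b i + get b (suc i)))

thetaCoeff-cong : ∀ {n} i (f g : Exp n → ℤ) → (∀ γ → f γ ≡ g γ) → ∀ b → thetaCoeff i f b ≡ thetaCoeff i g b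
thetaCoeff-cong i f g f≗g b with isZero (get b (suc i))
... | true = refl
... | false = cong₂ ℤ._-_ (f≗g _) (f≗g _)

thetaCoeff-+ : ∀ {n} i (f g : Exp n → ℤ) b →
  thetaCoeff i (λ γ → f γ ℤ.+ g γ) b ≡ thetaCoeff i f b ℤ.+ thetaCoeff i g b
thetaCoeff-+ i f g b with isZero (get b (suc i))
... | true = refl
... | false = interchange (f _) (g _) (f _) (g _)
  where
  interchange : ∀ a b c d → (a ℤ.+ b) ℤ.- (c ℤ.+ d) ≡ (a ℤ.- c) ℤ.+ (b ℤ.- d)
  interchange = solve-∀

thetaCoeff-when : ∀ {n} i a (g : Exp n → ℤ) b → thetaCoeff i (λ γ → when a (g γ)) b ≡ when a (thetaCoeff i g b)
thetaCoeff-when i true g b = refl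
thetaCoeff-when i false g b with isZero (get b (suc i))
... | true = refl
... | false = refl

interval : ℕ → ℕ → List ℕ
interval lo zero = []
interval lo (suc L) = lo ∷ interval (suc lo) L

applyUpTo-interval : ∀ (f : ℕ → ℕ) lo L → (∀ x → f x ≡ lo + x) → applyUpTo f L ≡ interval lo L
applyUpTo-interval f lo zero f≗ = refl
applyUpTo-interval f lo (suc L) f≗ =
  cong₂ _∷_ (trans (f≗ 0) (ℕP.+-identityʳ lo)) (applyUpTo-interval (f ∘ suc) (suc lo) L (λ x → trans (f≗ (suc x)) (ℕP.+-suc lo x)))

map-+-upTo : ∀ lo L → map (lo ℕ.+_) (upTo L) ≡ interval lo L
map-+-upTo lo L = trans (ListP.map-applyUpTo (λ x → x) (lo ℕ.+_) L) (applyUpTo-interval (lo ℕ.+_) lo L (λ _ → refl))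

inInterval : ℕ → ℕ → ℕ → Bool
inInterval lo zero y = false
inInterval lo (suc L) y = (lo ≡ᵇ y) ∨ inInterval (suc lo) L y

inInterval-suc : ∀ lo L y → inInterval (suc lo) L (suc y) ≡ inInterval lo L y
inInterval-suc lo zero y = refl
inInterval-suc lo (suc L) y = cong ((lo ≡ᵇ y) ∨_) (inInterval-suc (suc lo) L y)

inInterval-0 : ∀ lo L → inInterval (suc lo) L 0 ≡ false
inInterval-0 lo zero = refl
inInterval-0 lo (suc L) = inInterval-0 (suc lo) L

inInterval-below : ∀ lo L → inInterval (suc lo) L lo ≡ false
inInterval-below zero L = inInterval-0 0 L
inInterval-below (suc lo) L = trans (inInterval-suc (suc lo) L lo) (inInterval-below lo L)

coeff-antidiagonal : ∀ (d : ℤ) S lo L y₀ y₁ →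
  coeff (map (λ j → (d , j ∷ (S ∸ j) ∷ [])) (map (lo ℕ.+_) (upTo L))) (y₀ ∷ y₁ ∷ [])
    ≡ when (inInterval lo L y₀ ∧ (S ∸ y₀ ≡ᵇ y₁)) d
coeff-antidiagonal d S lo L y₀ y₁ rewrite map-+-upTo lo L = onInterval lo L y₀
  where
  onInterval : ∀ lo L y₀ → coeff (map (λ j → (d , j ∷ (S ∸ j) ∷ [])) (interval lo L)) (y₀ ∷ y₁ ∷ [])
                              ≡ when (inInterval lo L y₀ ∧ (S ∸ y₀ ≡ᵇ y₁)) d
  onInterval lo zero y₀ = refl
  onInterval lo (suc L) y₀ with lo ℕ.≟ y₀
  ... | yes refl
    rewrite ≡ᵇ-refl lo | onInterval (suc lo) L lo | inInterval-below lo L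
          | BoolP.∧-identityʳ (S ∸ lo ≡ᵇ y₁) = ℤP.+-identityʳ _
  ... | no lo≢y₀ rewrite ≢⇒≡ᵇ-false lo y₀ lo≢y₀ | onInterval (suc lo) L y₀ = ℤP.+-identityˡ _

inInterval-antidiagonal : ∀ x y z → inInterval 0 (suc x) y ∧ (x ∸ y ≡ᵇ z) ≡ (x ≡ᵇ y + z)
inInterval-antidiagonal zero zero z = refl
inInterval-antidiagonal zero (suc y) z = refl
inInterval-antidiagonal (suc x) zero z = refl
inInterval-antidiagonal (suc x) (suc y) z
  rewrite inInterval-suc 0 (suc x) y = inInterval-antidiagonal x y z

inInterval-antidiagonal-pos : ∀ x y z → inInterval 0 x y ∧ (x ∸ y ≡ᵇ z) ≡ (x ≡ᵇ y + z) ∧ not (isZero z)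
inInterval-antidiagonal-pos zero y zero = sym (BoolP.∧-zeroʳ _)
inInterval-antidiagonal-pos zero y (suc z) rewrite ℕP.+-suc y z = refl
inInterval-antidiagonal-pos (suc x) zero zero = refl
inInterval-antidiagonal-pos (suc x) zero (suc z) = sym (BoolP.∧-identityʳ _)
inInterval-antidiagonal-pos (suc x) (suc y) z
  rewrite inInterval-suc 0 x y = inInterval-antidiagonal-pos x y z

piCoeff₂ : ℤ → ℕ → ℕ → Exp 2 → ℤ
piCoeff₂ c x₀ x₁ y = termCoeff (c , x₀ ∷ x₁ ∷ []) y ℤ.+ thetaCoeff 0 (termCoeff (c , x₀ ∷ x₁ ∷ [])) y

piCoeff₂-right-0 : ∀ c x y₀ y₁ → piCoeff₂ c x 0 (y₀ ∷ y₁ ∷ []) ≡ when (x ≡ᵇ y₀ + y₁) c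
piCoeff₂-right-0 c x y₀ zero rewrite ℕP.+-identityʳ y₀ | BoolP.∧-identityʳ (x ≡ᵇ y₀) = ℤP.+-identityʳ _
piCoeff₂-right-0 c x y₀ (suc k)
  rewrite ℕP.+-suc y₀ k | BoolP.∧-zeroʳ (x ≡ᵇ y₀) | BoolP.∧-zeroʳ (x ≡ᵇ 0) | BoolP.∧-identityʳ (x ≡ᵇ suc (y₀ + k)) =
  trans (ℤP.+-identityˡ _) (ℤP.+-identityʳ _)

piCoeff₂-left-0 : ∀ c b y₀ y₁ → piCoeff₂ c 0 (suc b) (y₀ ∷ y₁ ∷ []) ≡ when (inInterval 1 b y₀ ∧ (suc b ∸ y₀ ≡ᵇ y₁)) (- c)
piCoeff₂-left-0 c b zero zero rewrite inInterval-0 0 b = refl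
piCoeff₂-left-0 c b zero (suc k) rewrite inInterval-0 0 b = cancel (when ((b ≡ᵇ k) ∧ true) c)
  where
  cancel : ∀ z → z ℤ.+ (+ 0 ℤ.- z) ≡ + 0
  cancel = solve-∀
piCoeff₂-left-0 c b (suc y) zero
  rewrite inInterval-suc 0 b y | inInterval-antidiagonal-pos b y 0 | BoolP.∧-zeroʳ (b ≡ᵇ y + 0) = refl
piCoeff₂-left-0 c b (suc y) (suc k)
  rewrite inInterval-suc 0 b y | inInterval-antidiagonal-pos b y (suc k) = sym (negate ((b ≡ᵇ y + suc k) ∧ true))
  where
  negate : ∀ X → when X (- c) ≡ + 0 ℤ.+ (+ 0 ℤ.- when X c)
  negate false = refl
  negate true = sym (trans (ℤP.+-identityˡ _) (ℤP.+-identityˡ _))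

coeff-full-antidiagonal : ∀ c x y₀ y₁ →
  coeff (map (λ j → (c , j ∷ (x + 0 ∸ j) ∷ [])) (map (0 ℕ.+_) (upTo (suc x)))) (y₀ ∷ y₁ ∷ []) ≡ when (x ≡ᵇ y₀ + y₁) c
coeff-full-antidiagonal c x y₀ y₁ rewrite coeff-antidiagonal c (x + 0) 0 (suc x) y₀ y₁ | ℕP.+-identityʳ x =
  cong (λ b → when b c) (inInterval-antidiagonal x y₀ y₁)

coeff-piTerm₂ : ∀ c x₀ x₁ y₀ y₁ → coeff (piTerm 0 (c , x₀ ∷ x₁ ∷ [])) (y₀ ∷ y₁ ∷ []) ≡ piCoeff₂ c x₀ x₁ (y₀ ∷ y₁ ∷ [])
coeff-piTerm₂ c (suc a) (suc b) y₀ zero = refl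
coeff-piTerm₂ c (suc a) (suc b) y₀ (suc k) rewrite BoolP.∧-zeroʳ (suc a ≡ᵇ y₀ + suc k) = refl
coeff-piTerm₂ c zero zero y₀ y₁ = trans (coeff-full-antidiagonal c 0 y₀ y₁) (sym (piCoeff₂-right-0 c 0 y₀ y₁))
coeff-piTerm₂ c (suc a) zero y₀ y₁ = trans (coeff-full-antidiagonal c (suc a) y₀ y₁) (sym (piCoeff₂-right-0 c (suc a) y₀ y₁))
coeff-piTerm₂ c zero (suc b) y₀ y₁ = trans (coeff-antidiagonal (- c) (suc b) 1 b y₀ y₁) (sym (piCoeff₂-left-0 c b y₀ y₁))

consTerm : ∀ {n} → ℕ → ℤ × Exp n → ℤ × Exp (suc n)
consTerm x (d , f) = (d , x ∷ f)

piTerm-cons : ∀ {n} i c x (e : Exp n) → piTerm (suc i) (c , x ∷ e) ≡ map (consTerm x) (piTerm i (c , e))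
piTerm-cons i c x e with isZero (get e i) ∨ isZero (get e (suc i))
... | false = refl
... | true with get e (suc i) ℕ.≤ᵇ get e i
... | true = ListP.map-∘ (map (get e (suc i) ℕ.+_) (upTo (suc (get e i ∸ get e (suc i)))))
... | false = ListP.map-∘ (map (suc (get e i) ℕ.+_) (upTo (get e (suc i) ∸ suc (get e i))))

coeff-map-consTerm : ∀ {n} x y (q : Poly n) b → coeff (map (consTerm x) q) (y ∷ b) ≡ when (x ≡ᵇ y) (coeff q b)
coeff-map-consTerm x y [] b = sym (when-0 (x ≡ᵇ y))
coeff-map-consTerm x y ((d , f) ∷ q) b =
  trans (cong₂ ℤ._+_ (sym (when-∧ (x ≡ᵇ y) _ d)) (coeff-map-consTerm x y q b)) (sym (when-+ (x ≡ᵇ y) _ _))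

thetaCoeff-cons : ∀ {n} i c x (e : Exp n) y b →
  thetaCoeff (suc i) (termCoeff (c , x ∷ e)) (y ∷ b) ≡ when (x ≡ᵇ y) (thetaCoeff i (termCoeff (c , e)) b)
thetaCoeff-cons i c x e y b =
  trans (thetaCoeff-cong i _ _ (λ z → sym (when-∧ (x ≡ᵇ y) (does (≡-dec ℕ._≟_ e z)) c)) b)
        (thetaCoeff-when i (x ≡ᵇ y) (termCoeff (c , e)) b)

appendTerm : ∀ {n} → Exp n → ℤ × Exp 2 → ℤ × Exp (suc (suc n))
appendTerm e (d , j ∷ k ∷ []) = (d , j ∷ k ∷ e)

piTerm-append : ∀ {n} c x₀ x₁ (e : Exp n) → piTerm 0 (c , x₀ ∷ x₁ ∷ e) ≡ map (appendTerm e) (piTerm 0 (c , x₀ ∷ x₁ ∷ []))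
piTerm-append c x₀ x₁ e with isZero x₀ ∨ isZero x₁
... | false = refl
... | true with x₁ ℕ.≤ᵇ x₀
... | true = ListP.map-∘ (map (x₁ ℕ.+_) (upTo (suc (x₀ ∸ x₁))))
... | false = ListP.map-∘ (map (suc x₀ ℕ.+_) (upTo (x₁ ∸ suc x₀)))

when-∧-∧ : ∀ a b E c → when (a ∧ (b ∧ E)) c ≡ when E (when (a ∧ (b ∧ true)) c)
when-∧-∧ a b true c = refl
when-∧-∧ a b false c rewrite BoolP.∧-zeroʳ b | BoolP.∧-zeroʳ a = refl

termCoeff-append : ∀ {n} c x₀ x₁ (e : Exp n) y₀ y₁ b →
  termCoeff (c , x₀ ∷ x₁ ∷ e) (y₀ ∷ y₁ ∷ b) ≡ when (does (≡-dec ℕ._≟_ e b)) (termCoeff (c , x₀ ∷ x₁ ∷ []) (y₀ ∷ y₁ ∷ []))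
termCoeff-append c x₀ x₁ e y₀ y₁ b = when-∧-∧ (x₀ ≡ᵇ y₀) (x₁ ≡ᵇ y₁) (does (≡-dec ℕ._≟_ e b)) c

coeff-map-appendTerm : ∀ {n} (e : Exp n) q y₀ y₁ b →
  coeff (map (appendTerm e) q) (y₀ ∷ y₁ ∷ b) ≡ when (does (≡-dec ℕ._≟_ e b)) (coeff q (y₀ ∷ y₁ ∷ []))
coeff-map-appendTerm e [] y₀ y₁ b = sym (when-0 _)
coeff-map-appendTerm e ((d , j ∷ k ∷ []) ∷ q) y₀ y₁ b =
  trans (cong₂ ℤ._+_ (termCoeff-append d j k e y₀ y₁ b) (coeff-map-appendTerm e q y₀ y₁ b))
        (sym (when-+ (does (≡-dec ℕ._≟_ e b)) _ (coeff q (y₀ ∷ y₁ ∷ []))))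

thetaCoeff-append : ∀ {n} c x₀ x₁ (e : Exp n) y₀ y₁ b →
  thetaCoeff 0 (termCoeff (c , x₀ ∷ x₁ ∷ e)) (y₀ ∷ y₁ ∷ b)
    ≡ when (does (≡-dec ℕ._≟_ e b)) (thetaCoeff 0 (termCoeff (c , x₀ ∷ x₁ ∷ [])) (y₀ ∷ y₁ ∷ []))
thetaCoeff-append c x₀ x₁ e y₀ y₁ b =
  trans (thetaCoeff-cong 0 (λ { (z₀ ∷ z₁ ∷ []) → termCoeff (c , x₀ ∷ x₁ ∷ e) (z₀ ∷ z₁ ∷ b) })
                         (λ z → when E (termCoeff (c , x₀ ∷ x₁ ∷ []) z))
                         (λ { (z₀ ∷ z₁ ∷ []) → termCoeff-append c x₀ x₁ e z₀ z₁ b }) (y₀ ∷ y₁ ∷ []))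
        (thetaCoeff-when 0 E (termCoeff (c , x₀ ∷ x₁ ∷ [])) (y₀ ∷ y₁ ∷ []))
  where
  E = does (≡-dec ℕ._≟_ e b)

coeff-piTerm : ∀ {n} i → suc i < n → ∀ t (b : Exp n) → coeff (piTerm i t) b ≡ termCoeff t b ℤ.+ thetaCoeff i (termCoeff t) b
coeff-piTerm zero (s≤s (s≤s _)) (c , x₀ ∷ x₁ ∷ e) (y₀ ∷ y₁ ∷ b) = begin
  coeff (piTerm 0 (c , x₀ ∷ x₁ ∷ e)) (y₀ ∷ y₁ ∷ b)
    ≡⟨ cong (λ q → coeff q (y₀ ∷ y₁ ∷ b)) (piTerm-append c x₀ x₁ e) ⟩
  coeff (map (appendTerm e) (piTerm 0 (c , x₀ ∷ x₁ ∷ []))) (y₀ ∷ y₁ ∷ b)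
    ≡⟨ coeff-map-appendTerm e (piTerm 0 (c , x₀ ∷ x₁ ∷ [])) y₀ y₁ b ⟩
  when E (coeff (piTerm 0 (c , x₀ ∷ x₁ ∷ [])) (y₀ ∷ y₁ ∷ []))
    ≡⟨ cong (when E) (coeff-piTerm₂ c x₀ x₁ y₀ y₁) ⟩
  when E (piCoeff₂ c x₀ x₁ (y₀ ∷ y₁ ∷ []))
    ≡⟨ when-+ E _ _ ⟩
  when E (termCoeff (c , x₀ ∷ x₁ ∷ []) (y₀ ∷ y₁ ∷ [])) ℤ.+ when E (thetaCoeff 0 (termCoeff (c , x₀ ∷ x₁ ∷ [])) (y₀ ∷ y₁ ∷ []))
    ≡⟨ sym (cong₂ ℤ._+_ (termCoeff-append c x₀ x₁ e y₀ y₁ b) (thetaCoeff-append c x₀ x₁ e y₀ y₁ b)) ⟩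
  termCoeff (c , x₀ ∷ x₁ ∷ e) (y₀ ∷ y₁ ∷ b) ℤ.+ thetaCoeff 0 (termCoeff (c , x₀ ∷ x₁ ∷ e)) (y₀ ∷ y₁ ∷ b) ∎
  where
  E = does (≡-dec ℕ._≟_ e b)
coeff-piTerm (suc i) (s≤s i<n) (c , x ∷ e) (y ∷ b) = begin
  coeff (piTerm (suc i) (c , x ∷ e)) (y ∷ b)
    ≡⟨ cong (λ q → coeff q (y ∷ b)) (piTerm-cons i c x e) ⟩
  coeff (map (consTerm x) (piTerm i (c , e))) (y ∷ b)
    ≡⟨ coeff-map-consTerm x y (piTerm i (c , e)) b ⟩
  when (x ≡ᵇ y) (coeff (piTerm i (c , e)) b)
    ≡⟨ cong (when (x ≡ᵇ y)) (coeff-piTerm i i<n (c , e) b) ⟩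
  when (x ≡ᵇ y) (termCoeff (c , e) b ℤ.+ thetaCoeff i (termCoeff (c , e)) b)
    ≡⟨ when-+ (x ≡ᵇ y) _ _ ⟩
  when (x ≡ᵇ y) (termCoeff (c , e) b) ℤ.+ when (x ≡ᵇ y) (thetaCoeff i (termCoeff (c , e)) b)
    ≡⟨ cong₂ ℤ._+_ (when-∧ (x ≡ᵇ y) _ c) (sym (thetaCoeff-cons i c x e y b)) ⟩
  termCoeff (c , x ∷ e) (y ∷ b) ℤ.+ thetaCoeff (suc i) (termCoeff (c , x ∷ e)) (y ∷ b) ∎

coeff-piT : ∀ {n} i → suc i < n → (p : Poly n) (b : Exp n) → coeff (piT i p) b ≡ coeff p b ℤ.+ thetaCoeff i (coeff p) b
coeff-piT i i<n [] b = sym (trans (ℤP.+-identityˡ _) (thetaCoeff-when i false (λ _ → + 0) b))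
coeff-piT i i<n (t ∷ p) b
  rewrite coeff-++ (piTerm i t) (piT i p) b | coeff-piTerm i i<n t b | coeff-piT i i<n p b
        | thetaCoeff-+ i (termCoeff t) (coeff p) b = ℤ-+-interchange (termCoeff t b) (thetaCoeff i (termCoeff t) b) (coeff p b) (thetaCoeff i (coeff p) b)

coeff-thetaT : ∀ {n} i → suc i < n → (p : Poly n) (b : Exp n) → coeff (thetaT i p) b ≡ thetaCoeff i (coeff p) b
coeff-thetaT i i<n p b
  rewrite coeff-++ (piT i p) (scaleP (- (+ 1)) p) b | coeff-piT i i<n p b | coeff-scaleP (- (+ 1)) p b = cancel (coeff p b) (thetaCoeff i (coeff p) b)
  where
  cancel : ∀ a t → (a ℤ.+ t) ℤ.+ (- (+ 1)) ℤ.* a ≡ t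
  cancel = solve-∀

-- Fundamental atoms are 0/1 indicator polynomials

getL : List ℕ → ℕ → ℕ
getL [] _ = 0
getL (x ∷ _) zero = x
getL (_ ∷ xs) (suc i) = getL xs i

setAtL : List ℕ → ℕ → ℕ → List ℕ
setAtL [] _ _ = []
setAtL (_ ∷ xs) zero v = v ∷ xs
setAtL (x ∷ xs) (suc i) v = x ∷ setAtL xs i v

pairAtL : List ℕ → ℕ → ℕ → ℕ → List ℕ
pairAtL l i x y = setAtL (setAtL l i x) (suc i) y

toList-get : ∀ {n} (v : Exp n) i → get v i ≡ getL (Vec.toList v) i
toList-get [] i = refl
toList-get (x ∷ v) zero = refl
toList-get (x ∷ v) (suc i) = toList-get v i

toList-setAt : ∀ {n} (v : Exp n) i y → Vec.toList (setAt v i y) ≡ setAtL (Vec.toList v) i y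
toList-setAt [] i y = refl
toList-setAt (x ∷ v) zero y = refl
toList-setAt (x ∷ v) (suc i) y = cong (x ∷_) (toList-setAt v i y)

toList-pairAt : ∀ {n} (v : Exp n) i x y → Vec.toList (pairAt v i x y) ≡ pairAtL (Vec.toList v) i x y
toList-pairAt v i x y = trans (toList-setAt (setAt v i x) (suc i) y) (cong (λ l → setAtL l (suc i) y) (toList-setAt v i x))

-- x^b is a monomial of Ã_γ iff every nonzero entry γₚ is the sum of b over the block of
-- positions after the previous nonzero entry of γ up to p, with bₚ > 0, and b vanishes
-- after the last nonzero entry of γ; acc is the sum of b over the current block so far.
inAtom : ℕ → List ℕ → List ℕ → Bool
inAtom acc [] [] = acc ≡ᵇ 0
inAtom acc [] (_ ∷ _) = false
inAtom acc (_ ∷ _) [] = false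
inAtom acc (zero ∷ γ) (x ∷ b) = inAtom (acc + x) γ b
inAtom acc (suc g ∷ γ) (zero ∷ b) = false
inAtom acc (suc g ∷ γ) (suc x ∷ b) = (acc + suc x ≡ᵇ suc g) ∧ inAtom 0 γ b

AtomIndicator : ∀ {n} → List ℕ → Poly n → Set
AtomIndicator {n} γ p = length γ ≡ n × (∀ b → coeff p b ≡ when (inAtom 0 γ (Vec.toList b)) (+ 1))

inAtom-vanishing-at-nonzero : ∀ acc u a w l s → inAtom acc (u ++ suc a ∷ 0 ∷ w) (pairAtL l (length u) 0 s) ≡ false
inAtom-vanishing-at-nonzero acc [] a w [] s = refl
inAtom-vanishing-at-nonzero acc [] a w (y ∷ l) s = refl
inAtom-vanishing-at-nonzero acc (g ∷ u) a w [] s = refl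
inAtom-vanishing-at-nonzero acc (zero ∷ u) a w (y ∷ l) s = inAtom-vanishing-at-nonzero (acc + y) u a w l s
inAtom-vanishing-at-nonzero acc (suc g ∷ u) a w (zero ∷ l) s = refl
inAtom-vanishing-at-nonzero acc (suc g ∷ u) a w (suc y ∷ l) s
  rewrite inAtom-vanishing-at-nonzero 0 u a w l s = BoolP.∧-zeroʳ _

inAtom-merge : ∀ acc u a w l →
  not (isZero (getL l (suc (length u))))
    ∧ inAtom acc (u ++ suc a ∷ 0 ∷ w) (pairAtL l (length u) (getL l (length u) + getL l (suc (length u))) 0)
  ≡ inAtom acc (u ++ 0 ∷ suc a ∷ w) l
inAtom-merge acc [] a w [] = refl
inAtom-merge acc [] a w (t ∷ []) = refl
inAtom-merge acc [] a w (t ∷ zero ∷ l) = refl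
inAtom-merge acc [] a w (t ∷ suc v ∷ l) rewrite ℕP.+-suc t v =
  cong (λ z → (z ≡ᵇ suc a) ∧ inAtom 0 w l) (trans (cong (acc ℕ.+_) (sym (ℕP.+-suc t v))) (sym (ℕP.+-assoc acc t (suc v))))
inAtom-merge acc (g ∷ u) a w [] = refl
inAtom-merge acc (zero ∷ u) a w (y ∷ l) = inAtom-merge (acc + y) u a w l
inAtom-merge acc (suc g ∷ u) a w (zero ∷ l) = BoolP.∧-zeroʳ _
inAtom-merge acc (suc g ∷ u) a w (suc y ∷ l) =
  trans (∧-swap (not (isZero (getL l (suc (length u))))) (acc + suc y ≡ᵇ suc g) _)
        (cong ((acc + suc y ≡ᵇ suc g) ∧_) (inAtom-merge 0 u a w l))

-- θ̃ᵢ moves the nonzero entry a of the pattern from position i to i+1: for bᵢ₊₁ > 0, merging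
-- bᵢ₊₁ into bᵢ lands in the old support iff b is in the new one (inAtom-merge), while the
-- subtracted term of thetaCoeff, which has a 0 at position i, never lies in the old support.
thetaCoeff-inAtom : ∀ {n} u a w (b : Exp n) →
  thetaCoeff (length u) (λ γ → when (inAtom 0 (u ++ suc a ∷ 0 ∷ w) (Vec.toList γ)) (+ 1)) b
    ≡ when (inAtom 0 (u ++ 0 ∷ suc a ∷ w) (Vec.toList b)) (+ 1)
thetaCoeff-inAtom u a w b
  rewrite toList-pairAt b (length u) (get b (length u) + get b (suc (length u))) 0
        | toList-pairAt b (length u) 0 (get b (length u) + get b (suc (length u)))
        | toList-get b (length u) | toList-get b (suc (length u))
        | inAtom-vanishing-at-nonzero 0 u a w (Vec.toList b) (getL (Vec.toList b) (length u) + getL (Vec.toList b) (suc (length u)))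
        | sym (inAtom-merge 0 u a w (Vec.toList b))
  with isZero (getL (Vec.toList b) (suc (length u)))
... | true = refl
... | false with inAtom 0 (u ++ suc a ∷ 0 ∷ w)
                   (pairAtL (Vec.toList b) (length u) (getL (Vec.toList b) (length u) + getL (Vec.toList b) (suc (length u))) 0)
...   | true = refl
...   | false = refl

thetaT-moveRight : ∀ {n} u a w (p : Poly n) →
  AtomIndicator (u ++ suc a ∷ 0 ∷ w) p → AtomIndicator (u ++ 0 ∷ suc a ∷ w) (thetaT (length u) p)
thetaT-moveRight {n} u a w p (len , ind) = len′ , λ b → begin
  coeff (thetaT (length u) p) b
    ≡⟨ coeff-thetaT (length u) i<n p b ⟩
  thetaCoeff (length u) (coeff p) b
    ≡⟨ thetaCoeff-cong (length u) _ _ ind b ⟩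
  thetaCoeff (length u) (λ γ → when (inAtom 0 (u ++ suc a ∷ 0 ∷ w) (Vec.toList γ)) (+ 1)) b
    ≡⟨ thetaCoeff-inAtom u a w b ⟩
  when (inAtom 0 (u ++ 0 ∷ suc a ∷ w) (Vec.toList b)) (+ 1) ∎
  where
  len′ : length (u ++ 0 ∷ suc a ∷ w) ≡ n
  len′ = trans (ListP.length-++ u) (trans (sym (ListP.length-++ u)) len)
  length-pair : ∀ (u : List ℕ) {x y w} → suc (length u) < length (u ++ x ∷ y ∷ w)
  length-pair [] = s≤s (s≤s z≤n)
  length-pair (_ ∷ u) = s≤s (length-pair u)
  i<n : suc (length u) < n
  i<n = subst (suc (length u) <_) len (length-pair u)

applyThetas : ∀ {n} → Poly n → List ℕ → Poly n
applyThetas = foldl (λ p i → thetaT i p)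

length-∷ʳ : ∀ (u : List ℕ) x → length (u ++ x ∷ []) ≡ suc (length u)
length-∷ʳ u x = trans (ListP.length-++ u) (ℕP.+-comm (length u) 1)

applyThetas-moveRight : ∀ {n} Z u x w (p : Poly n) →
  AtomIndicator (u ++ suc x ∷ replicate Z 0 ++ w) p →
  AtomIndicator (u ++ replicate Z 0 ++ suc x ∷ w) (applyThetas p (interval (length u) Z))
applyThetas-moveRight zero u x w p ind = ind
applyThetas-moveRight (suc Z) u x w p ind =
  subst₂ (λ k L → AtomIndicator L (applyThetas (thetaT (length u) p) (interval k Z)))
         (length-∷ʳ u 0) (ListP.++-assoc u (0 ∷ []) _)
         (applyThetas-moveRight Z (u ++ 0 ∷ []) x w (thetaT (length u) p)
           (subst (λ L → AtomIndicator L (thetaT (length u) p)) (sym (ListP.++-assoc u (0 ∷ []) _))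
             (thetaT-moveRight u x (replicate Z 0 ++ w) p ind)))

segments : ℕ → List ℕ → List (List ℕ)
segments j [] = []
segments j (p ∷ ps) = segment j p ∷ segments (suc j) ps

zipWith-segment : ∀ (f : ℕ → ℕ) j ps → (∀ x → f x ≡ j + x) → zipWith segment (applyUpTo f (length ps)) ps ≡ segments j ps
zipWith-segment f j [] f≗ = refl
zipWith-segment f j (p ∷ ps) f≗ =
  cong₂ _∷_ (cong (λ k → segment k p) (trans (f≗ 0) (ℕP.+-identityʳ j)))
            (zipWith-segment (f ∘ suc) (suc j) ps (λ x → trans (f≗ (suc x)) (ℕP.+-suc j x)))

-- atomWord γ = moves 0 (nzPos 0 γ): the θ̃'s slide the nonzero entries of flat γ, packed at
-- positions j, j+1, …, to the positions ps, the last entry first.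
moves : ℕ → List ℕ → List ℕ
moves j ps = concat (reverse (segments j ps))

moves-∷ : ∀ j p ps → moves j (p ∷ ps) ≡ moves (suc j) ps ++ segment j p
moves-∷ j p ps = begin
  concat (reverse (segment j p ∷ segments (suc j) ps))
    ≡⟨ cong concat (ListP.unfold-reverse (segment j p) (segments (suc j) ps)) ⟩
  concat (reverse (segments (suc j) ps) ++ segment j p ∷ [])
    ≡⟨ sym (ListP.concat-++ (reverse (segments (suc j) ps)) (segment j p ∷ [])) ⟩
  moves (suc j) ps ++ segment j p ++ []
    ≡⟨ cong (moves (suc j) ps ++_) (ListP.++-identityʳ (segment j p)) ⟩
  moves (suc j) ps ++ segment j p ∎

atomWord-moves : ∀ {n} (γ : Exp n) → atomWord γ ≡ moves 0 (nzPos 0 γ)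
atomWord-moves γ = cong (concat ∘ reverse) (zipWith-segment (λ x → x) 0 (nzPos 0 γ) (λ _ → refl))

segment-interval : ∀ j Z → segment j (j + Z) ≡ interval j Z
segment-interval j Z rewrite ℕP.m+n∸m≡n j Z = map-+-upTo j Z

nonzeros : ∀ {n} → Vec ℕ n → List ℕ
nonzeros [] = []
nonzeros (zero ∷ v) = nonzeros v
nonzeros (suc x ∷ v) = suc x ∷ nonzeros v

zeroCount : ∀ {n} → Vec ℕ n → ℕ
zeroCount [] = 0
zeroCount (zero ∷ v) = suc (zeroCount v)
zeroCount (suc x ∷ v) = zeroCount v

replicate-suc-++ : ∀ Z (l : List ℕ) → replicate (suc Z) 0 ++ l ≡ replicate Z 0 ++ 0 ∷ l
replicate-suc-++ zero l = refl
replicate-suc-++ (suc Z) l = cong (0 ∷_) (replicate-suc-++ Z l)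

applyThetas-moves : ∀ {n n′} (γ : Vec ℕ n′) u Z (p : Poly n) →
  AtomIndicator (u ++ nonzeros γ ++ replicate (Z + zeroCount γ) 0) p →
  AtomIndicator (u ++ replicate Z 0 ++ Vec.toList γ) (applyThetas p (moves (length u) (nzPos (length u + Z) γ)))
applyThetas-moves [] u Z p ind =
  subst (λ L → AtomIndicator L p)
        (cong (u ++_) (trans (cong (λ k → replicate k 0) (ℕP.+-identityʳ Z)) (sym (ListP.++-identityʳ _)))) ind
applyThetas-moves (zero ∷ γ) u Z p ind =
  subst₂ (λ k L → AtomIndicator L (applyThetas p (moves (length u) (nzPos k γ))))
         (ℕP.+-suc (length u) Z) (cong (u ++_) (replicate-suc-++ Z (Vec.toList γ)))
         (applyThetas-moves γ u (suc Z) p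
           (subst (λ k → AtomIndicator (u ++ nonzeros γ ++ replicate k 0) p) (ℕP.+-suc Z (zeroCount γ)) ind))
applyThetas-moves (suc x ∷ γ) u Z p ind
  rewrite moves-∷ (length u) (length u + Z) (nzPos (suc (length u + Z)) γ)
        | ListP.foldl-++ (λ p i → thetaT i p) p (moves (suc (length u)) (nzPos (suc (length u + Z)) γ)) (segment (length u) (length u + Z))
        | segment-interval (length u) Z
  = applyThetas-moveRight Z u x (Vec.toList γ) _
      (subst₂ (λ k L → AtomIndicator L (applyThetas p (moves k (nzPos (k + Z) γ))))
              (length-∷ʳ u (suc x)) (ListP.++-assoc u (suc x ∷ []) _)
              (applyThetas-moves γ (u ++ suc x ∷ []) Z p
                (subst (λ L → AtomIndicator L p) (sym (ListP.++-assoc u (suc x ∷ []) _)) ind)))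

toList-flat : ∀ {n} (γ : Exp n) → Vec.toList (flat γ) ≡ nonzeros γ ++ replicate (zeroCount γ) 0
toList-flat [] = refl
toList-flat (zero ∷ γ) = begin
  Vec.toList (flat γ Vec.∷ʳ 0)                           ≡⟨ toList-∷ʳ 0 (flat γ) ⟩
  Vec.toList (flat γ) ++ 0 ∷ []                          ≡⟨ cong (_++ 0 ∷ []) (toList-flat γ) ⟩
  (nonzeros γ ++ replicate (zeroCount γ) 0) ++ 0 ∷ []    ≡⟨ ListP.++-assoc (nonzeros γ) _ _ ⟩
  nonzeros γ ++ replicate (zeroCount γ) 0 ++ 0 ∷ []      ≡⟨ cong (nonzeros γ ++_) (sym (replicate-suc-++ (zeroCount γ) [])) ⟩
  nonzeros γ ++ replicate (suc (zeroCount γ)) 0 ++ []    ≡⟨ cong (nonzeros γ ++_) (ListP.++-identityʳ _) ⟩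
  nonzeros γ ++ replicate (suc (zeroCount γ)) 0          ∎
toList-flat (suc x ∷ γ) = cong (suc x ∷_) (toList-flat γ)

inAtom-refl : ∀ {n} (γ : Exp n) r → inAtom 0 (nonzeros γ ++ replicate r 0) (nonzeros γ ++ replicate r 0) ≡ true
inAtom-refl [] zero = refl
inAtom-refl [] (suc r) = inAtom-refl [] r
inAtom-refl (zero ∷ γ) r = inAtom-refl γ r
inAtom-refl (suc x ∷ γ) r rewrite ≡ᵇ-refl x = inAtom-refl γ r

inAtom-zeros : ∀ acc r l → inAtom acc (replicate r 0) l ≡ true → acc ≡ 0 × l ≡ replicate r 0
inAtom-zeros acc zero [] eq = ≡ᵇ⇒≡ acc 0 eq , refl
inAtom-zeros acc (suc r) (y ∷ l) eq with inAtom-zeros (acc + y) r l eq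
... | acc+y≡0 , l≡0 = ℕP.m+n≡0⇒m≡0 acc acc+y≡0 , cong₂ _∷_ (ℕP.m+n≡0⇒n≡0 acc acc+y≡0) l≡0

inAtom-flat : ∀ {n} (γ : Exp n) r l → inAtom 0 (nonzeros γ ++ replicate r 0) l ≡ true → l ≡ nonzeros γ ++ replicate r 0
inAtom-flat [] r l eq = proj₂ (inAtom-zeros 0 r l eq)
inAtom-flat (zero ∷ γ) r l eq = inAtom-flat γ r l eq
inAtom-flat (suc x ∷ γ) r (suc y ∷ l) eq =
  cong₂ _∷_ (≡ᵇ⇒≡ (suc y) (suc x) (BoolP.∧-conicalˡ _ _ eq)) (inAtom-flat γ r l (BoolP.∧-conicalʳ _ _ eq))

flat-indicator : ∀ {n} (γ : Exp n) → AtomIndicator (nonzeros γ ++ replicate (zeroCount γ) 0) ((+ 1 , flat γ) ∷ [])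
flat-indicator γ = trans (cong length (sym (toList-flat γ))) (VecP.length-toList (flat γ)) , indicator
  where
  indicator : ∀ b → coeff ((+ 1 , flat γ) ∷ []) b ≡ when (inAtom 0 (nonzeros γ ++ replicate (zeroCount γ) 0) (Vec.toList b)) (+ 1)
  indicator b with ≡-dec ℕ._≟_ (flat γ) b
  ... | yes refl rewrite toList-flat γ | inAtom-refl γ (zeroCount γ) = refl
  ... | no flat≢b with inAtom 0 (nonzeros γ ++ replicate (zeroCount γ) 0) (Vec.toList b) in eq
  ...   | false = refl
  ...   | true = ⊥-elim (flat≢b (trans (sym (VecP.cast-is-id refl (flat γ))) (VecP.toList-injective refl (flat γ) b
                                   (trans (toList-flat γ) (sym (inAtom-flat γ (zeroCount γ) (Vec.toList b) eq))))))

atom-indicator : ∀ {n} (γ : Exp n) → AtomIndicator (Vec.toList γ) (atom γ)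
atom-indicator γ rewrite atomWord-moves γ = applyThetas-moves γ [] 0 ((+ 1 , flat γ) ∷ []) (flat-indicator γ)

-- The product with Ã_α'

Strong : ∀ {k} → Vec ℕ k → Set
Strong = All (0 <_)

nzPos-zeros : ∀ j m → nzPos j (Vec.replicate m 0) ≡ []
nzPos-zeros j zero = refl
nzPos-zeros j (suc m) = nzPos-zeros (suc j) m

moves-padded : ∀ {k} m j (α : Vec ℕ k) → Strong α → moves j (nzPos j (padZeros m α)) ≡ []
moves-padded m j [] [] rewrite nzPos-zeros j m = refl
moves-padded m j (suc a ∷ α) (s≤s z≤n ∷ α⁺)
  rewrite moves-∷ j j (nzPos (suc j) (padZeros m α)) | moves-padded m (suc j) α α⁺ | ℕP.n∸n≡0 j = refl

flat-zeros : ∀ m → flat (Vec.replicate m 0) ≡ Vec.replicate m 0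
flat-zeros zero = refl
flat-zeros (suc m) rewrite flat-zeros m = replicate-∷ʳ m
  where
  replicate-∷ʳ : ∀ m → Vec.replicate m 0 Vec.∷ʳ 0 ≡ 0 ∷ Vec.replicate m 0
  replicate-∷ʳ zero = refl
  replicate-∷ʳ (suc m) = cong (0 ∷_) (replicate-∷ʳ m)

flat-padded : ∀ {k} m (α : Vec ℕ k) → Strong α → flat (padZeros m α) ≡ padZeros m α
flat-padded m [] [] = flat-zeros m
flat-padded m (suc a ∷ α) (s≤s z≤n ∷ α⁺) = cong (suc a ∷_) (flat-padded m α α⁺)

atom-padded : ∀ {k} m (α : Vec ℕ k) → Strong α → atom (padZeros m α) ≡ (+ 1 , padZeros m α) ∷ []
atom-padded m α α⁺ rewrite atomWord-moves (padZeros m α) | moves-padded m 0 α α⁺ | flat-padded m α α⁺ = refl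

_≤ᵛ_ : ∀ {n} → Vec ℕ n → Vec ℕ n → Bool
[] ≤ᵛ [] = true
(x ∷ e) ≤ᵛ (z ∷ c) = (x ℕ.≤ᵇ z) ∧ (e ≤ᵛ c)

_∸ᵛ_ : ∀ {n} → Vec ℕ n → Vec ℕ n → Vec ℕ n
_∸ᵛ_ = Vec.zipWith _∸_

zipWith-+-≟ : ∀ {n} (e f c : Vec ℕ n) →
  does (≡-dec ℕ._≟_ (Vec.zipWith _+_ e f) c) ≡ (e ≤ᵛ c) ∧ does (≡-dec ℕ._≟_ f (c ∸ᵛ e))
zipWith-+-≟ [] [] [] = refl
zipWith-+-≟ (x ∷ e) (y ∷ f) (z ∷ c) =
  trans (cong₂ _∧_ (+-≡ᵇ x y z) (zipWith-+-≟ e f c)) (∧-interchange (x ℕ.≤ᵇ z) (y ≡ᵇ z ∸ x) (e ≤ᵛ c) _)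

coeff-monomial-*P : ∀ {n} (e : Exp n) q c → coeff (((+ 1 , e) ∷ []) *P q) c ≡ when (e ≤ᵛ c) (coeff q (c ∸ᵛ e))
coeff-monomial-*P e [] c = sym (when-0 (e ≤ᵛ c))
coeff-monomial-*P e ((d , f) ∷ q) c = begin
  when (does (≡-dec ℕ._≟_ (Vec.zipWith _+_ e f) c)) (+ 1 ℤ.* d) ℤ.+ coeff (((+ 1 , e) ∷ []) *P q) c
    ≡⟨ cong₂ ℤ._+_ (cong₂ when (zipWith-+-≟ e f c) (ℤP.*-identityˡ d)) (coeff-monomial-*P e q c) ⟩
  when ((e ≤ᵛ c) ∧ D) d ℤ.+ when (e ≤ᵛ c) (coeff q (c ∸ᵛ e))
    ≡⟨ cong (ℤ._+ when (e ≤ᵛ c) (coeff q (c ∸ᵛ e))) (sym (when-∧ (e ≤ᵛ c) D d)) ⟩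
  when (e ≤ᵛ c) (when D d) ℤ.+ when (e ≤ᵛ c) (coeff q (c ∸ᵛ e))
    ≡⟨ sym (when-+ (e ≤ᵛ c) (when D d) _) ⟩
  when (e ≤ᵛ c) (coeff ((d , f) ∷ q) (c ∸ᵛ e)) ∎
  where
  D = does (≡-dec ℕ._≟_ f (c ∸ᵛ e))

inAtomPrefix : ℕ → List ℕ → List ℕ → Maybe ℕ
inAtomPrefix acc [] [] = just acc
inAtomPrefix acc [] (_ ∷ _) = nothing
inAtomPrefix acc (_ ∷ _) [] = nothing
inAtomPrefix acc (zero ∷ γ) (x ∷ b) = inAtomPrefix (acc + x) γ b
inAtomPrefix acc (suc g ∷ γ) (zero ∷ b) = nothing
inAtomPrefix acc (suc g ∷ γ) (suc x ∷ b) = if acc + suc x ≡ᵇ suc g then inAtomPrefix 0 γ b else nothing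

inAtom-++ : ∀ acc γ δ b c → length γ ≡ length b →
  inAtom acc (γ ++ δ) (b ++ c) ≡ maybe′ (λ carry → inAtom carry δ c) false (inAtomPrefix acc γ b)
inAtom-++ acc [] δ [] c _ = refl
inAtom-++ acc (zero ∷ γ) δ (x ∷ b) c eq = inAtom-++ (acc + x) γ δ b c (ℕP.suc-injective eq)
inAtom-++ acc (suc g ∷ γ) δ (zero ∷ b) c eq = refl
inAtom-++ acc (suc g ∷ γ) δ (suc x ∷ b) c eq with acc + suc x ≡ᵇ suc g
... | true = inAtom-++ 0 γ δ b c (ℕP.suc-injective eq)
... | false = refl

absorbCarry : ∀ {m} → ℕ → Vec ℕ m → Vec ℕ m
absorbCarry a [] = []
absorbCarry a (zero ∷ δ) = zero ∷ absorbCarry a δ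
absorbCarry a (suc g ∷ δ) = (suc g ∸ a) ∷ δ

carryFits : ℕ → List ℕ → Bool
carryFits a [] = a ≡ᵇ 0
carryFits a (zero ∷ δ) = carryFits a δ
carryFits a (suc g ∷ δ) = a ℕ.<ᵇ suc g

inAtom-absorbCarry : ∀ {m} acc a (δ : Vec ℕ m) l → carryFits a (Vec.toList δ) ≡ true →
  inAtom acc (Vec.toList (absorbCarry a δ)) l ≡ inAtom (acc + a) (Vec.toList δ) l
inAtom-absorbCarry acc a [] [] fits rewrite ≡ᵇ⇒≡ a 0 fits | ℕP.+-identityʳ acc = refl
inAtom-absorbCarry acc a [] (_ ∷ _) fits = refl
inAtom-absorbCarry acc a (zero ∷ δ) [] fits = refl
inAtom-absorbCarry acc a (zero ∷ δ) (y ∷ l) fits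
  rewrite inAtom-absorbCarry (acc + y) a δ l fits = cong (λ z → inAtom z (Vec.toList δ) l) (+-right-comm acc y a)
inAtom-absorbCarry acc a (suc g ∷ δ) [] fits = refl
inAtom-absorbCarry acc a (suc g ∷ δ) (y ∷ l) fits with ℕP.<ᵇ⇒< a (suc g) (≡true⇒T fits)
inAtom-absorbCarry acc a (suc g ∷ δ) (zero ∷ l) fits | s≤s a≤g rewrite ℕP.+-∸-assoc 1 a≤g = refl
inAtom-absorbCarry acc a (suc g ∷ δ) (suc y ∷ l) fits | s≤s a≤g rewrite ℕP.+-∸-assoc 1 a≤g =
  cong (_∧ inAtom 0 (Vec.toList δ) l) (≡ᵇ-cong _ _ _ _ to from)
  where
  to : acc + suc y ≡ suc (g ∸ a) → acc + a + suc y ≡ suc g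
  to eq = trans (+-right-comm acc a (suc y)) (trans (cong (_+ a) eq) (cong suc (ℕP.m∸n+n≡m a≤g)))
  from : acc + a + suc y ≡ suc g → acc + suc y ≡ suc (g ∸ a)
  from eq = begin
    acc + suc y           ≡⟨ sym (ℕP.m+n∸n≡m (acc + suc y) a) ⟩
    acc + suc y + a ∸ a   ≡⟨ cong (_∸ a) (+-right-comm acc (suc y) a) ⟩
    acc + a + suc y ∸ a   ≡⟨ cong (_∸ a) eq ⟩
    suc g ∸ a             ≡⟨ ℕP.+-∸-assoc 1 a≤g ⟩
    suc (g ∸ a)           ∎

carryFits-+ : ∀ a y δ → carryFits (a + y) δ ≡ true → carryFits a δ ≡ true
carryFits-+ a y [] fits rewrite ℕP.m+n≡0⇒m≡0 a (≡ᵇ⇒≡ (a + y) 0 fits) = refl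
carryFits-+ a y (zero ∷ δ) fits = carryFits-+ a y δ fits
carryFits-+ a y (suc g ∷ δ) fits =
  T⇒≡true (ℕP.<⇒<ᵇ (ℕP.≤-<-trans (ℕP.m≤m+n a y) (ℕP.<ᵇ⇒< (a + y) (suc g) (≡true⇒T fits))))

inAtom⇒carryFits : ∀ a δ l → inAtom a δ l ≡ true → carryFits a δ ≡ true
inAtom⇒carryFits a [] [] match = match
inAtom⇒carryFits a (zero ∷ δ) (x ∷ l) match = carryFits-+ a x δ (inAtom⇒carryFits (a + x) δ l match)
inAtom⇒carryFits a (suc g ∷ δ) (suc x ∷ l) match =
  T⇒≡true (ℕP.<⇒<ᵇ (subst (a <_) (≡ᵇ⇒≡ _ _ (BoolP.∧-conicalˡ _ _ match)) (ℕP.m<m+n a (s≤s z≤n))))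

inAtom-strong-++ : ∀ {k} (w c : Vec ℕ k) X Y → Strong w →
  inAtom 0 (Vec.toList w ++ X) (Vec.toList c ++ Y) ≡ does (≡-dec ℕ._≟_ w c) ∧ inAtom 0 X Y
inAtom-strong-++ [] [] X Y [] = refl
inAtom-strong-++ (suc g ∷ w) (zero ∷ c) X Y (s≤s z≤n ∷ w⁺) = refl
inAtom-strong-++ (suc g ∷ w) (suc x ∷ c) X Y (s≤s z≤n ∷ w⁺)
  rewrite inAtom-strong-++ w c X Y w⁺ | ≡ᵇ-sym x g = sym (BoolP.∧-assoc (g ≡ᵇ x) (does (≡-dec ℕ._≟_ w c)) (inAtom 0 X Y))

≤ᵛ-strong : ∀ {k} (α w : Vec ℕ k) → Strong α → α ≤ᵛ w ≡ true → Strong w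
≤ᵛ-strong [] [] [] _ = []
≤ᵛ-strong (suc a ∷ α) (suc x ∷ w) (s≤s z≤n ∷ α⁺) α≤w = s≤s z≤n ∷ ≤ᵛ-strong α w α⁺ (BoolP.∧-conicalʳ _ _ α≤w)

inAtom-sum : ∀ acc γ l → inAtom acc γ l ≡ true → acc + sum l ≡ sum γ
inAtom-sum acc [] [] match rewrite ≡ᵇ⇒≡ acc 0 match = refl
inAtom-sum acc (zero ∷ γ) (x ∷ l) match = trans (sym (ℕP.+-assoc acc x (sum l))) (inAtom-sum (acc + x) γ l match)
inAtom-sum acc (suc g ∷ γ) (suc x ∷ l) match =
  trans (sym (ℕP.+-assoc acc (suc x) (sum l)))
        (cong₂ _+_ (≡ᵇ⇒≡ _ _ (BoolP.∧-conicalˡ _ _ match)) (inAtom-sum 0 γ l (BoolP.∧-conicalʳ _ _ match)))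

∑ : {A : Set} → List A → (A → ℤ) → ℤ
∑ [] f = + 0
∑ (x ∷ xs) f = f x ℤ.+ ∑ xs f

∑-++ : ∀ {A : Set} (xs ys : List A) f → ∑ (xs ++ ys) f ≡ ∑ xs f ℤ.+ ∑ ys f
∑-++ [] ys f = sym (ℤP.+-identityˡ _)
∑-++ (x ∷ xs) ys f rewrite ∑-++ xs ys f = sym (ℤP.+-assoc (f x) (∑ xs f) (∑ ys f))

∑-concatMap : ∀ {A B : Set} (g : A → List B) xs f → ∑ (concatMap g xs) f ≡ ∑ xs (λ x → ∑ (g x) f)
∑-concatMap g [] f = refl
∑-concatMap g (x ∷ xs) f = trans (∑-++ (g x) (concatMap g xs) f) (cong (λ z → ∑ (g x) f ℤ.+ z) (∑-concatMap g xs f))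

∑-map : ∀ {A B : Set} (h : A → B) xs f → ∑ (map h xs) f ≡ ∑ xs (f ∘ h)
∑-map h [] f = refl
∑-map h (x ∷ xs) f = cong (λ z → f (h x) ℤ.+ z) (∑-map h xs f)

∑-cong : ∀ {A : Set} xs (f g : A → ℤ) → (∀ x → f x ≡ g x) → ∑ xs f ≡ ∑ xs g
∑-cong [] f g f≗g = refl
∑-cong (x ∷ xs) f g f≗g = cong₂ ℤ._+_ (f≗g x) (∑-cong xs f g f≗g)

∑-when : ∀ {A : Set} xs b (f : A → ℤ) → ∑ xs (λ x → when b (f x)) ≡ when b (∑ xs f)
∑-when xs true f = refl
∑-when [] false f = refl
∑-when (x ∷ xs) false f = trans (ℤP.+-identityˡ _) (∑-when xs false f)

coeff-concatMap : ∀ {A : Set} {n} (g : A → Poly n) xs c → coeff (concatMap g xs) c ≡ ∑ xs (λ x → coeff (g x) c)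
coeff-concatMap g [] c = refl
coeff-concatMap g (x ∷ xs) c = trans (coeff-++ (g x) (concatMap g xs) c) (cong (λ z → coeff (g x) c ℤ.+ z) (coeff-concatMap g xs c))

∑-interval-select : ∀ lo L y (f : ℕ → ℤ) → ∑ (interval lo L) (λ x → when (x ≡ᵇ y) (f x)) ≡ when (inInterval lo L y) (f y)
∑-interval-select lo zero y f = refl
∑-interval-select lo (suc L) y f with lo ℕ.≟ y
... | yes refl rewrite ≡ᵇ-refl lo | ∑-interval-select (suc lo) L lo f | inInterval-below lo L = ℤP.+-identityʳ _
... | no lo≢y rewrite ≢⇒≡ᵇ-false lo y lo≢y | ∑-interval-select (suc lo) L y f = ℤP.+-identityˡ _

inInterval-≤ᵇ : ∀ N y → inInterval 0 (suc N) y ≡ (y ℕ.≤ᵇ N)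
inInterval-≤ᵇ N zero = refl
inInterval-≤ᵇ zero (suc y) = refl
inInterval-≤ᵇ (suc N) (suc y) rewrite inInterval-suc 0 (suc N) y | inInterval-≤ᵇ N y = sym (<ᵇ-suc y N)

box : ∀ k → ℕ → List (Vec ℕ k)
box zero N = [] ∷ []
box (suc k) N = concatMap (λ x → map (x ∷_) (box k N)) (interval 0 (suc N))

∑-box-select : ∀ k N (f : Vec ℕ k → ℤ) c →
  ∑ (box k N) (λ w → when (does (≡-dec ℕ._≟_ w c)) (f w)) ≡ when (c ≤ᵛ Vec.replicate k N) (f c)
∑-box-select zero N f [] = ℤP.+-identityʳ _
∑-box-select (suc k) N f (y ∷ c) = begin
  ∑ (box (suc k) N) (λ w → when (does (≡-dec ℕ._≟_ w (y ∷ c))) (f w))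
    ≡⟨ ∑-concatMap (λ x → map (x ∷_) (box k N)) (interval 0 (suc N)) _ ⟩
  ∑ (interval 0 (suc N)) (λ x → ∑ (map (x ∷_) (box k N)) (λ w → when (does (≡-dec ℕ._≟_ w (y ∷ c))) (f w)))
    ≡⟨ ∑-cong (interval 0 (suc N)) _ _ column ⟩
  ∑ (interval 0 (suc N)) (λ x → when (x ≡ᵇ y) (when (c ≤ᵛ Vec.replicate k N) (f (x ∷ c))))
    ≡⟨ ∑-interval-select 0 (suc N) y (λ x → when (c ≤ᵛ Vec.replicate k N) (f (x ∷ c))) ⟩
  when (inInterval 0 (suc N) y) (when (c ≤ᵛ Vec.replicate k N) (f (y ∷ c)))
    ≡⟨ cong (λ b → when b (when (c ≤ᵛ Vec.replicate k N) (f (y ∷ c)))) (inInterval-≤ᵇ N y) ⟩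
  when (y ℕ.≤ᵇ N) (when (c ≤ᵛ Vec.replicate k N) (f (y ∷ c)))
    ≡⟨ when-∧ (y ℕ.≤ᵇ N) _ _ ⟩
  when ((y ∷ c) ≤ᵛ Vec.replicate (suc k) N) (f (y ∷ c)) ∎
  where
  column : ∀ x → ∑ (map (x ∷_) (box k N)) (λ w → when (does (≡-dec ℕ._≟_ w (y ∷ c))) (f w))
                 ≡ when (x ≡ᵇ y) (when (c ≤ᵛ Vec.replicate k N) (f (x ∷ c)))
  column x = begin
    ∑ (map (x ∷_) (box k N)) (λ w → when (does (≡-dec ℕ._≟_ w (y ∷ c))) (f w))
      ≡⟨ ∑-map (x ∷_) (box k N) _ ⟩
    ∑ (box k N) (λ w → when ((x ≡ᵇ y) ∧ does (≡-dec ℕ._≟_ w c)) (f (x ∷ w)))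
      ≡⟨ ∑-cong (box k N) _ _ (λ w → sym (when-∧ (x ≡ᵇ y) _ _)) ⟩
    ∑ (box k N) (λ w → when (x ≡ᵇ y) (when (does (≡-dec ℕ._≟_ w c)) (f (x ∷ w))))
      ≡⟨ ∑-when (box k N) (x ≡ᵇ y) _ ⟩
    when (x ≡ᵇ y) (∑ (box k N) (λ w → when (does (≡-dec ℕ._≟_ w c)) (f (x ∷ w))))
      ≡⟨ cong (when (x ≡ᵇ y)) (∑-box-select k N (λ w → f (x ∷ w)) c) ⟩
    when (x ≡ᵇ y) (when (c ≤ᵛ Vec.replicate k N) (f (x ∷ c))) ∎

≤ᵛ-replicate : ∀ {k} N (c : Vec ℕ k) → sum (Vec.toList c) ℕ.≤ N → c ≤ᵛ Vec.replicate k N ≡ true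
≤ᵛ-replicate N [] _ = refl
≤ᵛ-replicate N (x ∷ c) x+c≤N
  rewrite T⇒≡true (ℕP.≤⇒≤ᵇ (ℕP.≤-trans (ℕP.m≤m+n x (sum (Vec.toList c))) x+c≤N))
        | ≤ᵛ-replicate N c (ℕP.≤-trans (ℕP.m≤n+m (sum (Vec.toList c)) x) x+c≤N) = refl

sum-∸ᵛ : ∀ {k} (α c : Vec ℕ k) → α ≤ᵛ c ≡ true → sum (Vec.toList c) ≡ sum (Vec.toList (c ∸ᵛ α)) + sum (Vec.toList α)
sum-∸ᵛ [] [] _ = refl
sum-∸ᵛ (a ∷ α) (x ∷ c) α≤c rewrite sum-∸ᵛ α c (BoolP.∧-conicalʳ _ _ α≤c) =
  trans (cong (_+ (sum (Vec.toList (c ∸ᵛ α)) + sum (Vec.toList α)))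
              (sym (ℕP.m∸n+n≡m (ℕP.≤ᵇ⇒≤ a x (≡true⇒T (BoolP.∧-conicalˡ _ _ α≤c))))))
        (+-interchange (x ∸ a) a _ _)

≤ᵛ-padded : ∀ {k} m (α c₁ : Vec ℕ k) (c₂ : Vec ℕ m) → padZeros m α ≤ᵛ (c₁ Vec.++ c₂) ≡ α ≤ᵛ c₁
≤ᵛ-padded m [] [] c₂ = zeros-≤ᵛ m c₂
  where
  zeros-≤ᵛ : ∀ m (c : Vec ℕ m) → Vec.replicate m 0 ≤ᵛ c ≡ true
  zeros-≤ᵛ zero [] = refl
  zeros-≤ᵛ (suc m) (x ∷ c) = zeros-≤ᵛ m c
≤ᵛ-padded m (a ∷ α) (x ∷ c₁) c₂ = cong ((a ℕ.≤ᵇ x) ∧_) (≤ᵛ-padded m α c₁ c₂)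

∸ᵛ-padded : ∀ {k} m (α c₁ : Vec ℕ k) (c₂ : Vec ℕ m) → (c₁ Vec.++ c₂) ∸ᵛ padZeros m α ≡ (c₁ ∸ᵛ α) Vec.++ c₂
∸ᵛ-padded m [] [] c₂ = ∸ᵛ-zeros m c₂
  where
  ∸ᵛ-zeros : ∀ m (c : Vec ℕ m) → c ∸ᵛ Vec.replicate m 0 ≡ c
  ∸ᵛ-zeros zero [] = refl
  ∸ᵛ-zeros (suc m) (x ∷ c) = cong (x ∷_) (∸ᵛ-zeros m c)
∸ᵛ-padded m (a ∷ α) (x ∷ c₁) c₂ = cong ((x ∸ a) ∷_) (∸ᵛ-padded m α c₁ c₂)

module Product {k m : ℕ} (α : Vec ℕ k) (α⁺ : Strong α) (β₁ : Vec ℕ k) (β₂ : Vec ℕ m) where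

  carry : Vec ℕ k → Maybe ℕ
  carry w = inAtomPrefix 0 (Vec.toList β₁) (Vec.toList (w ∸ᵛ α))

  admissible : Vec ℕ k → Bool
  admissible w = (α ≤ᵛ w) ∧ maybe′ (λ a → carryFits a (Vec.toList β₂)) false (carry w)

  weight : Vec ℕ k → ℕ
  weight w = if admissible w then 1 else 0

  -- The default 0 is junk: when carry w is nothing, the term has weight 0.
  completion : Vec ℕ k → Vec ℕ m
  completion w = absorbCarry (fromMaybe 0 (carry w)) β₂

  -- Every exponent in the support of the product has total degree |α| + |β|.
  bound : ℕ
  bound = sum (Vec.toList α) + sum (Vec.toList β₁ ++ Vec.toList β₂)

  terms : List (ℕ × Vec ℕ (k + m))
  terms = map (λ w → (weight w , w Vec.++ completion w)) (box k bound)

  completionCoeff : Vec ℕ m → Vec ℕ k → ℤ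
  completionCoeff c₂ w = + weight w ℤ.* when (inAtom 0 (Vec.toList (completion w)) (Vec.toList c₂)) (+ 1)

  sameLength-β₁ : ∀ (c : Vec ℕ k) → length (Vec.toList β₁) ≡ length (Vec.toList c)
  sameLength-β₁ c = trans (VecP.length-toList β₁) (sym (VecP.length-toList c))

  coeff-product : ∀ c₁ c₂ → coeff (atom (padZeros m α) *P atom (β₁ Vec.++ β₂)) (c₁ Vec.++ c₂)
    ≡ when (α ≤ᵛ c₁) (when (maybe′ (λ a → inAtom a (Vec.toList β₂) (Vec.toList c₂)) false (carry c₁)) (+ 1))
  coeff-product c₁ c₂
    rewrite atom-padded m α α⁺
          | coeff-monomial-*P (padZeros m α) (atom (β₁ Vec.++ β₂)) (c₁ Vec.++ c₂)
          | proj₂ (atom-indicator (β₁ Vec.++ β₂)) ((c₁ Vec.++ c₂) ∸ᵛ padZeros m α)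
          | ≤ᵛ-padded m α c₁ c₂ | ∸ᵛ-padded m α c₁ c₂
          | VecP.toList-++ β₁ β₂ | VecP.toList-++ (c₁ ∸ᵛ α) c₂
          | inAtom-++ 0 (Vec.toList β₁) (Vec.toList β₂) (Vec.toList (c₁ ∸ᵛ α)) (Vec.toList c₂) (sameLength-β₁ (c₁ ∸ᵛ α))
    = refl

  coeff-term : ∀ c₁ c₂ w → coeff (scaleP (+ weight w) (atom (w Vec.++ completion w))) (c₁ Vec.++ c₂)
    ≡ when (does (≡-dec ℕ._≟_ w c₁)) (completionCoeff c₂ w)
  coeff-term c₁ c₂ w
    rewrite coeff-scaleP (+ weight w) (atom (w Vec.++ completion w)) (c₁ Vec.++ c₂)
          | proj₂ (atom-indicator (w Vec.++ completion w)) (c₁ Vec.++ c₂)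
    with admissible w in adm
  ... | false = sym (when-0 _)
  ... | true
    rewrite VecP.toList-++ w (completion w) | VecP.toList-++ c₁ c₂
          | inAtom-strong-++ w c₁ (Vec.toList (completion w)) (Vec.toList c₂)
              (≤ᵛ-strong α w α⁺ (BoolP.∧-conicalˡ _ _ adm))
    = one-∧ (does (≡-dec ℕ._≟_ w c₁)) _
    where
    one-∧ : ∀ a b → + 1 ℤ.* when (a ∧ b) (+ 1) ≡ when a (+ 1 ℤ.* when b (+ 1))
    one-∧ true b = refl
    one-∧ false b = refl

  coeff-terms : ∀ c₁ c₂ → coeff (atomComb terms) (c₁ Vec.++ c₂) ≡ when (c₁ ≤ᵛ Vec.replicate k bound) (completionCoeff c₂ c₁)
  coeff-terms c₁ c₂ = begin
    coeff (atomComb terms) (c₁ Vec.++ c₂)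
      ≡⟨ coeff-concatMap _ terms (c₁ Vec.++ c₂) ⟩
    ∑ terms _
      ≡⟨ ∑-map (λ w → (weight w , w Vec.++ completion w)) (box k bound) _ ⟩
    ∑ (box k bound) (λ w → coeff (scaleP (+ weight w) (atom (w Vec.++ completion w))) (c₁ Vec.++ c₂))
      ≡⟨ ∑-cong (box k bound) _ _ (coeff-term c₁ c₂) ⟩
    ∑ (box k bound) (λ w → when (does (≡-dec ℕ._≟_ w c₁)) (completionCoeff c₂ w))
      ≡⟨ ∑-box-select k bound (completionCoeff c₂) c₁ ⟩
    when (c₁ ≤ᵛ Vec.replicate k bound) (completionCoeff c₂ c₁) ∎

  bounded : ∀ c₁ (c₂ : Vec ℕ m) a → α ≤ᵛ c₁ ≡ true → carry c₁ ≡ just a → inAtom a (Vec.toList β₂) (Vec.toList c₂) ≡ true →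
    c₁ ≤ᵛ Vec.replicate k bound ≡ true
  bounded c₁ c₂ a α≤c₁ carry≡ match = ≤ᵛ-replicate bound c₁ (subst (ℕ._≤ bound) (sym (sum-∸ᵛ α c₁ α≤c₁)) sum≤)
    where
    β = Vec.toList β₁ ++ Vec.toList β₂
    d = Vec.toList (c₁ ∸ᵛ α)
    whole : inAtom 0 β (d ++ Vec.toList c₂) ≡ true
    whole = trans (inAtom-++ 0 (Vec.toList β₁) (Vec.toList β₂) d (Vec.toList c₂) (sameLength-β₁ (c₁ ∸ᵛ α)))
                  (trans (cong (maybe′ (λ a → inAtom a (Vec.toList β₂) (Vec.toList c₂)) false) carry≡) match)
    d≤β : sum d ℕ.≤ sum β
    d≤β = subst (sum d ℕ.≤_) (trans (sym (sum-++ d (Vec.toList c₂))) (inAtom-sum 0 β _ whole))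
                (ℕP.m≤m+n (sum d) (sum (Vec.toList c₂)))
    sum≤ : sum d + sum (Vec.toList α) ℕ.≤ bound
    sum≤ = subst (sum d + sum (Vec.toList α) ℕ.≤_) (ℕP.+-comm (sum β) (sum (Vec.toList α))) (ℕP.+-monoˡ-≤ (sum (Vec.toList α)) d≤β)

  coeff-product-completion : ∀ c₁ c₂ →
    when (α ≤ᵛ c₁) (when (maybe′ (λ a → inAtom a (Vec.toList β₂) (Vec.toList c₂)) false (carry c₁)) (+ 1))
      ≡ when (c₁ ≤ᵛ Vec.replicate k bound) (completionCoeff c₂ c₁)
  coeff-product-completion c₁ c₂ with α ≤ᵛ c₁ in α≤c₁ | carry c₁ in carry≡
  ... | false | _ = sym (when-0 _)
  ... | true | nothing = sym (when-0 _)
  ... | true | just a with carryFits a (Vec.toList β₂) in fits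
  ...   | false with inAtom a (Vec.toList β₂) (Vec.toList c₂) in match
  ...     | false = sym (when-0 _)
  ...     | true with () ← trans (sym fits) (inAtom⇒carryFits a (Vec.toList β₂) (Vec.toList c₂) match)
  coeff-product-completion c₁ c₂ | true | just a | true
    rewrite inAtom-absorbCarry 0 a β₂ (Vec.toList c₂) fits with inAtom a (Vec.toList β₂) (Vec.toList c₂) in match
  ... | false = sym (when-0 _)
  ... | true rewrite bounded c₁ c₂ a α≤c₁ carry≡ match = refl

  decomposition : (atom (padZeros m α) *P atom (β₁ Vec.++ β₂)) ≈P atomComb terms
  decomposition c with Vec.splitAt k c
  ... | c₁ , c₂ , refl = trans (coeff-product c₁ c₂) (trans (coeff-product-completion c₁ c₂) (sym (coeff-terms c₁ c₂)))

mainTheorem7 : (k m : ℕ) (α : Vec ℕ k) → All (λ a → 0 < a) α → (β : Vec ℕ (k + m)) →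
    Σ (List (ℕ × Vec ℕ (k + m))) (λ cs → (atom (padZeros m α) *P atom β) ≈P atomComb cs)
mainTheorem7 k m α α⁺ β with Vec.splitAt k β
... | β₁ , β₂ , refl = Product.terms α α⁺ β₁ β₂ , Product.decomposition α α⁺ β₁ β₂
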